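{- Let $\Gamma_1=(G,\varphi_1)$ and $\Gamma_2=(G,\varphi_2)$ be additive rational gain graphs on the same underlying graph $G$ (vertex set $\{1,\dots,\ell\}$, no loops), each with all circles of length $2$ unbalanced. If $\Gamma_1$ and $\Gamma_2$ are switching equivalent, then $\phi_3(\mathcal{A}(\Gamma_1))=\phi_3(\mathcal{A}(\Gamma_2))$.
   Context: A gain graph $\Gamma=(G,\varphi)$: finite graph $G$ with gain map $\varphi$ assigning a rational number to each oriented edge with $\varphi(\mathtt e^{ -1})=-\varphi(\mathtt e)$. A circle is balanced if the sum of gains along it is $0$. Switching $\Gamma$ by a function $\lambda\colon V(G)\to\mathbb Q$ replaces $\varphi(\mathtt e)$ by $-\lambda(v)+\varphi(\mathtt e)+\lambda(w)$ for $\mathtt e$ oriented from $v$ to $w$; two gain graphs on $G$ are switching equivalent if one is obtained from the other by switching. The canonical complete lift representation $\mathcal{A}(\Gamma)$ is the central arrangement in $\mathbb C^{\ell+1}$ (coordinates $x_0,\dots,x_\ell$) consisting of $\{x_0=0\}$ and, for each edge $\mathtt e$ oriented from $i$ to $j$, the hyperplane $\{x_i-x_j+\varphi(\mathtt e)x_0=0\}$. Falk invariant: for a central arrangement with hyperplanes $H_0,\dots,H_n$, $H_i=\alpha_i^{ -1}(0)$, let $E$ be the exterior algebra over $\mathbb C$ on $e_0,\dots,e_n$ with graded pieces $E^p$, and $\partial$ the degree $-1$ derivation with $\partial e_i=1$. A subset $S$ is dependent if $\{\alpha_i:i\in S\}$ is linearly dependent. The Orlik–Solomon ideal $I$ is generated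 by $\partial e_S$ for $S$ dependent, $I^p=I\cap E^p$, and $\phi_3=\dim\ker(E^1\otimes I^2\to E^3,\ a\otimes b\mapsto a\wedge b)$. -}

module Defs where

open import Data.Nat using (ℕ; zero; suc)
open import Data.Bool using (Bool; true; false; if_then_else_; _∧_)
open import Data.Fin using (Fin; zero; suc; _≟_)
open import Data.Fin.Subset using (Subset; ∣_∣; ⁅_⁆; _∈_; _∉_)
open import Data.Vec using ([]; _∷_)
open import Data.Rational using (ℚ; 0ℚ; 1ℚ; _+_; _*_; -_)
open import Data.Product using (Σ; ∃; _×_; _,_)
open import Relation.Binary.PropositionalEquality using (_≡_; _≢_)
open import Relation.Nullary.Decidable using (⌊_⌋)

sumFin : (n : ℕ) → (Fin n → ℚ) → ℚ
sumFin zero    f = 0ℚ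
sumFin (suc n) f = f zero + sumFin n (λ i → f (suc i))

sumSub : (n : ℕ) → (Subset n → ℚ) → ℚ
sumSub zero    f = f []
sumSub (suc n) f = sumSub n (λ s → f (false ∷ s)) + sumSub n (λ s → f (true ∷ s))

signPow : ℕ → ℚ
signPow zero    = 1ℚ
signPow (suc k) = - signPow k

ind : ∀ {n} → Fin n → Fin n → ℚ
ind i j = if ⌊ i ≟ j ⌋ then 1ℚ else 0ℚ

eqSub : ∀ {n} → Subset n → Subset n → Bool
eqSub []      []      = true
eqSub (true  ∷ S) (true  ∷ T) = eqSub S T
eqSub (false ∷ S) (false ∷ T) = eqSub S T
eqSub (true  ∷ S) (false ∷ T) = false
eqSub (false ∷ S) (true  ∷ T) = false

-- A finite graph on vertex set Fin ℓ (= {1,…,ℓ}), multiple edges allowed,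
-- no loops.  Each edge e has a reference orientation tail e → head e.
record Graph (ℓ : ℕ) : Set where
  field
    m        : ℕ
    tail     : Fin m → Fin ℓ
    head     : Fin m → Fin ℓ
    loopless : ∀ e → tail e ≢ head e

open Graph public

-- A rational gain map is given by the gain of each edge in its reference
-- orientation; the opposite orientation gets the negated gain.
Gain : ∀ {ℓ} → Graph ℓ → Set
Gain G = Fin (m G) → ℚ

-- oriented edges: (e , true) = e from tail to head, (e , false) = e⁻¹
OEdge : ∀ {ℓ} → Graph ℓ → Set
OEdge G = Σ (Fin (m G)) (λ _ → Bool)

src : ∀ {ℓ} (G : Graph ℓ) → OEdge G → Fin ℓ
src G (e , true)  = tail G e
src G (e , false) = head G e

tgt : ∀ {ℓ} (G : Graph ℓ) → OEdge G → Fin ℓ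
tgt G (e , true)  = head G e
tgt G (e , false) = tail G e

ogain : ∀ {ℓ} (G : Graph ℓ) → Gain G → OEdge G → ℚ
ogain G φ (e , true)  = φ e
ogain G φ (e , false) = - φ e

-- Circles of length 2: two distinct edges e, f traversed as a closed walk
-- v →e→ w →f→ v.  Such a circle is balanced iff the gain sum is 0.
-- Hypothesis: every circle of length 2 is unbalanced.
AllTwoCirclesUnbalanced : ∀ {ℓ} (G : Graph ℓ) → Gain G → Set
AllTwoCirclesUnbalanced G φ =
  ∀ (o₁ o₂ : OEdge G) →
    Σ.proj₁ o₁ ≢ Σ.proj₁ o₂ →
    tgt G o₁ ≡ src G o₂ →
    tgt G o₂ ≡ src G o₁ →
    ogain G φ o₁ + ogain G φ o₂ ≢ 0ℚ

switch : ∀ {ℓ} (G : Graph ℓ) → (Fin ℓ → ℚ) → Gain G → Gain G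
switch G lam φ e = (- lam (tail G e)) + φ e + lam (head G e)

SwitchingEquivalent : ∀ {ℓ} (G : Graph ℓ) → Gain G → Gain G → Set
SwitchingEquivalent {ℓ} G φ₁ φ₂ =
  ∃ λ (lam : Fin ℓ → ℚ) → ∀ e → switch G lam φ₁ e ≡ φ₂ e

record Arrangement : Set where
  field
    d     : ℕ
    n     : ℕ
    forms : Fin n → Fin d → ℚ

open Arrangement public

-- Canonical complete lift representation A(Γ) in coordinates x₀,…,x_ℓ,
-- where coordinate zero is x₀ and coordinate (suc i) is x_i (vertex i).
-- Hyperplane zero is {x₀ = 0}; hyperplane (suc e) is
-- {x_{tail e} - x_{head e} + φ(e) x₀ = 0}.
canonicalLift : ∀ {ℓ} (G : Graph ℓ) → Gain G → Arrangement
canonicalLift {ℓ} G φ = record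
  { d = suc ℓ
  ; n = suc (m G)
  ; forms = α
  }
  where
  α : Fin (suc (m G)) → Fin (suc ℓ) → ℚ
  α zero    j = ind zero j
  α (suc e) j = ind (suc (tail G e)) j + (- ind (suc (head G e)) j) + φ e * ind zero j

-- Exterior algebra E on e₀,…,e_{n-1} over ℚ:
-- an element is its coefficient function on the basis e_S (S ⊆ [n],
-- e_S = e_{s₁} ∧ … ∧ e_{s_p} with s₁ < … < s_p).

Ext : ℕ → Set
Ext n = Subset n → ℚ

-- wedgeCoef S T U = coefficient of e_U in e_S ∧ e_T
wedgeCoef : ∀ {n} → Subset n → Subset n → Subset n → ℚ
wedgeCoef []          []          []          = 1ℚ
wedgeCoef (false ∷ S) (false ∷ T) (false ∷ U) = wedgeCoef S T U
wedgeCoef (true  ∷ S) (false ∷ T) (true  ∷ U) = wedgeCoef S T U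
wedgeCoef (false ∷ S) (true  ∷ T) (true  ∷ U) = signPow ∣ S ∣ * wedgeCoef S T U
wedgeCoef (_     ∷ S) (_     ∷ T) (_     ∷ U) = 0ℚ

_∧E_ : ∀ {n} → Ext n → Ext n → Ext n
_∧E_ {n} x y U = sumSub n (λ S → sumSub n (λ T → wedgeCoef S T U * (x S * y T)))

eVec : ∀ {n} → Fin n → Ext n
eVec i U = if eqSub U ⁅ i ⁆ then 1ℚ else 0ℚ

-- ∂ : the degree -1 derivation with ∂ eᵢ = 1.
-- ∂Coef S U = coefficient of e_U in ∂ e_S,
-- i.e. ∂(e_{s₁}∧…∧e_{s_p}) = Σ_k (-1)^{k-1} e_{s₁}∧…ê_{s_k}…∧e_{s_p}.
∂Coef : ∀ {n} → Subset n → Subset n → ℚ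
∂Coef []          []          = 0ℚ
∂Coef (true  ∷ S) (false ∷ U) = if eqSub S U then 1ℚ else 0ℚ
∂Coef (true  ∷ S) (true  ∷ U) = - ∂Coef S U
∂Coef (false ∷ S) (false ∷ U) = ∂Coef S U
∂Coef (false ∷ S) (true  ∷ U) = 0ℚ

∂e : ∀ {n} → Subset n → Ext n
∂e S U = ∂Coef S U

_≈E_ : ∀ {n} → Ext n → Ext n → Set
x ≈E y = ∀ U → x U ≡ y U

Dependent : (A : Arrangement) → Subset (n A) → Set
Dependent A S =
  Σ (Fin (n A) → ℚ) λ c →
    (∀ i → i ∉ S → c i ≡ 0ℚ) ×
    (∃ λ i → c i ≢ 0ℚ) ×
    (∀ j → sumFin (n A) (λ i → c i * forms A i j) ≡ 0ℚ)

-- membership in the (two-sided = left, E being graded commutative) ideal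
-- generated by {∂ e_S : S dependent}
InOSIdeal : (A : Arrangement) → Ext (n A) → Set
InOSIdeal A x =
  Σ ℕ λ k →
  Σ (Fin k → Ext (n A)) λ a →
  Σ (Fin k → Subset (n A)) λ S →
    (∀ j → Dependent A (S j)) ×
    (x ≈E (λ U → sumFin k (λ j → (a j ∧E ∂e (S j)) U)))

Homogeneous : ∀ {n} → ℕ → Ext n → Set
Homogeneous p x = ∀ U → ∣ U ∣ ≢ p → x U ≡ 0ℚ

InI2 : (A : Arrangement) → Ext (n A) → Set
InI2 A x = InOSIdeal A x × Homogeneous 2 x

IsBasisOf : {X : Set} → ((X → ℚ) → Set) → (d : ℕ) → (Fin d → X → ℚ) → Set
IsBasisOf {X} P d v =
  (∀ k → P (v k)) ×
  (∀ (c : Fin d → ℚ) → (∀ x → sumFin d (λ k → c k * v k x) ≡ 0ℚ) → ∀ k → c k ≡ 0ℚ) ×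
  (∀ w → P w → Σ (Fin d → ℚ) λ c → ∀ x → w x ≡ sumFin d (λ k → c k * v k x))

HasDim : {X : Set} → ((X → ℚ) → Set) → ℕ → Set
HasDim P d = Σ _ λ v → IsBasisOf P d v

-- E¹ ⊗ I² is identified with (I²)^n via Σᵢ eᵢ ⊗ bᵢ ↔ (bᵢ)ᵢ; an element is
-- a function w : Fin n × Subset n → ℚ with bᵢ = w (i , -).
-- The multiplication map sends it to Σᵢ eᵢ ∧ bᵢ ∈ E³.
InFalkKernel : (A : Arrangement) → (Σ (Fin (n A)) (λ _ → Subset (n A)) → ℚ) → Set
InFalkKernel A w =
  (∀ i → InI2 A (λ U → w (i , U))) ×
  ((λ U → sumFin (n A) (λ i → (eVec i ∧E (λ V → w (i , V))) U)) ≈E (λ _ → 0ℚ))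

Phi3 : Arrangement → ℕ → Set
Phi3 A δ = HasDim (InFalkKernel A) δ

-- Switching by lam is the linear substitution x_v ↦ x_v − lam v · x₀ of the coordinates,
-- which carries the defining forms of A(φ) to those of A(switch lam φ). A linear relation
-- among forms survives composition with a linear map, and switching back by −lam gives the
-- converse, so both arrangements have the same dependent sets; the Orlik–Solomon ideal,
-- and with it φ₃, is determined by the dependent sets.
module Submission where

open import Defs
open import Algebra.Bundles using (CommutativeRing)
open import Data.Nat using (ℕ; zero; suc)
open import Data.Fin using (Fin; zero; suc; _≟_)
open import Data.Product using (_×_; _,_; proj₁; proj₂)
open import Data.Rational using (ℚ; 0ℚ; 1ℚ; _+_; _*_; -_)
open import Data.Rational.Properties
  using (+-*-commutativeRing; +-identityˡ; +-identityʳ; *-identityˡ; *-zeroˡ; *-zeroʳ)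
open import Data.Rational.Solver using (module +-*-Solver)
open import Relation.Binary.PropositionalEquality
open import Relation.Nullary using (yes; no)

open import Algebra.Properties.Semiring.Sum (CommutativeRing.semiring +-*-commutativeRing)
  using (sum; sum-syntax; sum-cong-≗; sum-replicate-zero; ∑-comm; ∑-distrib-+; *-distribˡ-sum)
open import Algebra.Properties.CommutativeSemigroup
  (CommutativeRing.*-commutativeSemigroup +-*-commutativeRing)
  using (x∙yz≈y∙xz)
open +-*-Solver using (solve; con; _:+_; _:*_; :-_; _:=_)
open ≡-Reasoning

sumFin≡sum : ∀ n (f : Fin n → ℚ) → sumFin n f ≡ sum f
sumFin≡sum zero    f = refl
sumFin≡sum (suc n) f = cong (f zero +_) (sumFin≡sum n (λ i → f (suc i)))

ind-suc : ∀ {n} (u v : Fin n) → ind (suc u) (suc v) ≡ ind u v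
ind-suc u v with u ≟ v
... | yes _ = refl
... | no  _ = refl

∑-ind : ∀ n (u : Fin n) (f : Fin n → ℚ) → ∑[ v < n ] (ind u v * f v) ≡ f u
∑-ind (suc n) zero f = begin
  1ℚ * f zero + ∑[ v < n ] (0ℚ * f (suc v))  ≡⟨ cong₂ _+_ (*-identityˡ (f zero))
                                                 (sum-cong-≗ (λ v → *-zeroˡ (f (suc v)))) ⟩
  f zero + ∑[ v < n ] 0ℚ                     ≡⟨ cong (f zero +_) (sum-replicate-zero n) ⟩
  f zero + 0ℚ                                ≡⟨ +-identityʳ (f zero) ⟩
  f zero                                     ∎
∑-ind (suc n) (suc u) f = begin
  0ℚ * f zero + ∑[ v < n ] (ind (suc u) (suc v) * f (suc v))
    ≡⟨ cong₂ _+_ (*-zeroˡ (f zero)) (sum-cong-≗ (λ v → cong (_* f (suc v)) (ind-suc u v))) ⟩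
  0ℚ + ∑[ v < n ] (ind u v * f (suc v))
    ≡⟨ +-identityˡ _ ⟩
  ∑[ v < n ] (ind u v * f (suc v))
    ≡⟨ ∑-ind n u (λ v → f (suc v)) ⟩
  f (suc u) ∎

HasDim-cong : ∀ {X : Set} {P Q : (X → ℚ) → Set} →
  (∀ w → P w → Q w) → (∀ w → Q w → P w) → ∀ d → HasDim P d → HasDim Q d
HasDim-cong P⇒Q Q⇒P d (v , v∈P , independent , spanning) =
  v , (λ k → P⇒Q (v k) (v∈P k)) , independent , (λ w w∈Q → spanning w (Q⇒P w w∈Q))

-- canonicalLift G φ is definitionally arrangementOf (forms (canonicalLift G φ)), by record η.
arrangementOf : ∀ {n d} → (Fin n → Fin d → ℚ) → Arrangement
arrangementOf {n} {d} α = record { d = d ; n = n ; forms = α }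

module _ {n d d′ : ℕ} (α : Fin n → Fin d → ℚ) (β : Fin n → Fin d′ → ℚ) where

  private
    A B : Arrangement
    A = arrangementOf α
    B = arrangementOf β

  Dependent-linearImage : (M : Fin d′ → Fin d → ℚ) →
    (∀ i j → β i j ≡ ∑[ k < d ] (M j k * α i k)) →
    ∀ S → Dependent A S → Dependent B S
  Dependent-linearImage M β≡Mα S (c , outside , nonzero , relation) =
    c , outside , nonzero , relation′
    where
    relation′ : ∀ j → sumFin n (λ i → c i * β i j) ≡ 0ℚ
    relation′ j = begin
      sumFin n (λ i → c i * β i j)
        ≡⟨ sumFin≡sum n _ ⟩
      ∑[ i < n ] (c i * β i j)
        ≡⟨ sum-cong-≗ (λ i → cong (c i *_) (β≡Mα i j)) ⟩
      ∑[ i < n ] (c i * ∑[ k < d ] (M j k * α i k))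
        ≡⟨ sum-cong-≗ (λ i → *-distribˡ-sum (c i) (λ k → M j k * α i k)) ⟩
      ∑[ i < n ] ∑[ k < d ] (c i * (M j k * α i k))
        ≡⟨ ∑-comm (λ i k → c i * (M j k * α i k)) ⟩
      ∑[ k < d ] ∑[ i < n ] (c i * (M j k * α i k))
        ≡⟨ sum-cong-≗ (λ k → sum-cong-≗ (λ i → x∙yz≈y∙xz (c i) (M j k) (α i k))) ⟩
      ∑[ k < d ] ∑[ i < n ] (M j k * (c i * α i k))
        ≡˘⟨ sum-cong-≗ (λ k → *-distribˡ-sum (M j k) (λ i → c i * α i k)) ⟩
      ∑[ k < d ] (M j k * ∑[ i < n ] (c i * α i k))
        ≡˘⟨ sum-cong-≗ (λ k → cong (M j k *_) (sumFin≡sum n _)) ⟩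
      ∑[ k < d ] (M j k * sumFin n (λ i → c i * α i k))
        ≡⟨ sum-cong-≗ (λ k → trans (cong (M j k *_) (relation k)) (*-zeroʳ (M j k))) ⟩
      ∑[ k < d ] 0ℚ
        ≡⟨ sum-replicate-zero d ⟩
      0ℚ ∎

  module _ (A⇒B : ∀ S → Dependent A S → Dependent B S) where

    InOSIdeal-mono : ∀ x → InOSIdeal A x → InOSIdeal B x
    InOSIdeal-mono x (k , a , S , S-dependent , x≈) =
      k , a , S , (λ j → A⇒B (S j) (S-dependent j)) , x≈

    InFalkKernel-mono : ∀ w → InFalkKernel A w → InFalkKernel B w
    InFalkKernel-mono w (w∈I² , wedge≈0) =
      (λ i → InOSIdeal-mono _ (proj₁ (w∈I² i)) , proj₂ (w∈I² i)) , wedge≈0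

Phi3-cong : ∀ {n d d′} (α : Fin n → Fin d → ℚ) (β : Fin n → Fin d′ → ℚ) →
  (∀ S → Dependent (arrangementOf α) S → Dependent (arrangementOf β) S) →
  (∀ S → Dependent (arrangementOf β) S → Dependent (arrangementOf α) S) →
  ∀ δ → Phi3 (arrangementOf α) δ → Phi3 (arrangementOf β) δ
Phi3-cong α β A⇒B B⇒A =
  HasDim-cong (InFalkKernel-mono α β A⇒B) (InFalkKernel-mono β α B⇒A)

-- Transpose of the matrix of the substitution x_v ↦ x_v − lam v · x₀, fixing x₀;
-- it acts on coefficient vectors of linear forms.
shear : ∀ {ℓ} → (Fin ℓ → ℚ) → Fin (suc ℓ) → Fin (suc ℓ) → ℚ
shear lam zero    zero    = 1ℚ
shear lam zero    (suc v) = - lam v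
shear lam (suc w) zero    = 0ℚ
shear lam (suc w) (suc v) = ind w v

module _ {ℓ} (G : Graph ℓ) where

  private
    α : Gain G → Fin (suc (m G)) → Fin (suc ℓ) → ℚ
    α φ = forms (canonicalLift G φ)

  canonicalLift-forms-suc : ∀ (φ φ′ : Gain G) i v → α φ′ i (suc v) ≡ α φ i (suc v)
  canonicalLift-forms-suc φ φ′ zero    v = refl
  canonicalLift-forms-suc φ φ′ (suc e) v =
    cong (ind (suc (tail G e)) (suc v) + - ind (suc (head G e)) (suc v) +_)
         (trans (*-zeroʳ (φ′ e)) (sym (*-zeroʳ (φ e))))

  ∑-edgeForm : ∀ (φ : Gain G) e (μ : Fin ℓ → ℚ) →
    ∑[ v < ℓ ] (μ v * α φ (suc e) (suc v)) ≡ μ (tail G e) + - μ (head G e)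
  ∑-edgeForm φ e μ = begin
    ∑[ v < ℓ ] (μ v * α φ (suc e) (suc v))
      ≡⟨ sum-cong-≗ pointwise ⟩
    ∑[ v < ℓ ] (ind t v * μ v + ind h v * - μ v)
      ≡⟨ ∑-distrib-+ (λ v → ind t v * μ v) (λ v → ind h v * - μ v) ⟩
    ∑[ v < ℓ ] (ind t v * μ v) + ∑[ v < ℓ ] (ind h v * - μ v)
      ≡⟨ cong₂ _+_ (∑-ind ℓ t μ) (∑-ind ℓ h (λ v → - μ v)) ⟩
    μ t + - μ h ∎
    where
    t = tail G e
    h = head G e
    pointwise : ∀ v → μ v * α φ (suc e) (suc v) ≡ ind t v * μ v + ind h v * - μ v
    pointwise v rewrite ind-suc t v | ind-suc h v =
      solve 4 (λ x a b p → x :* (a :+ :- b :+ p :* con 0ℚ) := a :* x :+ b :* (:- x))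
        refl (μ v) (ind t v) (ind h v) (φ e)

  canonicalLift-switch : ∀ (lam : Fin ℓ → ℚ) {φ φ′ : Gain G} →
    (∀ e → switch G lam φ e ≡ φ′ e) →
    ∀ i j → α φ′ i j ≡ ∑[ k < suc ℓ ] (shear lam j k * α φ i k)
  canonicalLift-switch lam {φ} {φ′} switched i (suc w) = begin
    α φ′ i (suc w)
      ≡⟨ canonicalLift-forms-suc φ φ′ i w ⟩
    α φ i (suc w)
      ≡˘⟨ ∑-ind ℓ w (λ v → α φ i (suc v)) ⟩
    ∑[ v < ℓ ] (ind w v * α φ i (suc v))
      ≡˘⟨ +-identityˡ _ ⟩
    0ℚ + ∑[ v < ℓ ] (ind w v * α φ i (suc v))
      ≡˘⟨ cong (_+ ∑[ v < ℓ ] (ind w v * α φ i (suc v))) (*-zeroˡ (α φ i zero)) ⟩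
    0ℚ * α φ i zero + ∑[ v < ℓ ] (ind w v * α φ i (suc v)) ∎
  canonicalLift-switch lam {φ} {φ′} switched zero zero = begin
    1ℚ
      ≡˘⟨ +-identityʳ 1ℚ ⟩
    1ℚ + 0ℚ
      ≡˘⟨ cong (1ℚ +_) (sum-replicate-zero ℓ) ⟩
    1ℚ + ∑[ v < ℓ ] 0ℚ
      ≡˘⟨ cong (1ℚ +_) (sum-cong-≗ (λ v → *-zeroʳ (- lam v))) ⟩
    1ℚ * 1ℚ + ∑[ v < ℓ ] (- lam v * 0ℚ) ∎
  canonicalLift-switch lam {φ} {φ′} switched (suc e) zero = begin
    0ℚ + - 0ℚ + φ′ e * 1ℚ
      ≡˘⟨ cong (λ z → 0ℚ + - 0ℚ + z * 1ℚ) (switched e) ⟩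
    0ℚ + - 0ℚ + (- lam t + φ e + lam h) * 1ℚ
      ≡⟨ solve 3 (λ a p b → con 0ℚ :+ :- con 0ℚ :+ (:- a :+ p :+ b) :* con 1ℚ
                         := con 1ℚ :* (con 0ℚ :+ :- con 0ℚ :+ p :* con 1ℚ) :+ (:- a :+ :- (:- b)))
                 refl (lam t) (φ e) (lam h) ⟩
    1ℚ * α φ (suc e) zero + (- lam t + - - lam h)
      ≡˘⟨ cong (1ℚ * α φ (suc e) zero +_) (∑-edgeForm φ e (λ v → - lam v)) ⟩
    1ℚ * α φ (suc e) zero + ∑[ v < ℓ ] (- lam v * α φ (suc e) (suc v)) ∎
    where
    t = tail G e
    h = head G e

  SwitchingEquivalent-sym : ∀ {φ₁ φ₂ : Gain G} →
    SwitchingEquivalent G φ₁ φ₂ → SwitchingEquivalent G φ₂ φ₁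
  SwitchingEquivalent-sym {φ₁} {φ₂} (lam , switched) = (λ v → - lam v) , switched-back
    where
    switched-back : ∀ e → switch G (λ v → - lam v) φ₂ e ≡ φ₁ e
    switched-back e = begin
      - - lam t + φ₂ e + - lam h
        ≡˘⟨ cong (λ z → - - lam t + z + - lam h) (switched e) ⟩
      - - lam t + (- lam t + φ₁ e + lam h) + - lam h
        ≡⟨ solve 3 (λ a p b → :- (:- a) :+ (:- a :+ p :+ b) :+ :- b := p) refl (lam t) (φ₁ e) (lam h) ⟩
      φ₁ e ∎
      where
      t = tail G e
      h = head G e

  Dependent-switch : ∀ {φ φ′ : Gain G} → SwitchingEquivalent G φ φ′ →
    ∀ S → Dependent (canonicalLift G φ) S → Dependent (canonicalLift G φ′) S
  Dependent-switch {φ} {φ′} (lam , switched) =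
    Dependent-linearImage (α φ) (α φ′) (shear lam) (canonicalLift-switch lam switched)

  Phi3-switch : ∀ {φ φ′ : Gain G} → SwitchingEquivalent G φ φ′ →
    ∀ δ → Phi3 (canonicalLift G φ) δ → Phi3 (canonicalLift G φ′) δ
  Phi3-switch {φ} {φ′} equivalent =
    Phi3-cong (α φ) (α φ′) (Dependent-switch equivalent)
                           (Dependent-switch (SwitchingEquivalent-sym equivalent))

corollary3p10 : ∀ {ℓ} (G : Graph ℓ) (φ₁ φ₂ : Gain G) →
    AllTwoCirclesUnbalanced G φ₁ →
    AllTwoCirclesUnbalanced G φ₂ →
    SwitchingEquivalent G φ₁ φ₂ →
    ∀ (δ : ℕ) →
      (Phi3 (canonicalLift G φ₁) δ → Phi3 (canonicalLift G φ₂) δ) ×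
      (Phi3 (canonicalLift G φ₂) δ → Phi3 (canonicalLift G φ₁) δ)
corollary3p10 G φ₁ φ₂ _ _ equivalent δ =
  Phi3-switch G equivalent δ , Phi3-switch G (SwitchingEquivalent-sym G equivalent) δ
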